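{- Let $\Gamma\vdash A$ be a sequent of Constructive Natural Deduction such that $\Gamma$ contains atomic propositions only. If $\Gamma\vdash A$ has a specific-cut-free proof in Constructive Natural Deduction, then $\Gamma\vdash f(A)$ has a proof in the pseudo-automaton $\mathcal{A}$, and for each leaf $\Delta\vdash B$ of this proof that is proved with the delay rule, the sequent $u(\Delta)\vdash u(B)$ has a proof in Constructive Natural Deduction.
   Context: Propositions are first-order formulas built from atomic propositions $P(t_1,\dots,t_k)$ ($P$ a predicate symbol; $\top$ and $\bot$ are not atomic), $\top$, $\bot$, $\wedge$, $\vee$, $\Rightarrow$, $\forall$, $\exists$. Sequents are $\Gamma\vdash A$ with $\Gamma$ a finite list of propositions. Constructive Natural Deduction has the introduction rules: axiom $\Gamma,A\vdash A$; $\top$-intro $\Gamma\vdash\top$; $\wedge$-intro (from $\Gamma\vdash A$, $\Gamma\vdash B$ infer $\Gamma\vdash A\wedge B$); $\vee$-intro (from $\Gamma\vdash A$, or from $\Gamma\vdash B$, infer $\Gamma\vdash A\vee B$); $\Rightarrow$-intro (from $\Gamma,A\vdash B$ infer $\Gamma\vdash A\Rightarrow B$); $\forall$-intro (from $\Gamma\vdash A$ infer $\Gamma\vdash\forall x\,A$, $x$ not free in $\Gamma$); $\exists$-intro (from $\Gamma\vdash(t/x)A$ infer $\Gamma\vdash\exists x\,A$); and the elimination rules, whose leftmost premise is the major one: $\bot$-elim (from $\Gamma\vdash\bot$ infer $\Gamma\vdash A$); $\wedge$-elim (from $\Gamma\vdash A\wedge B$ infer $\Gamma\vdash A$, or $\Gamma\vdash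 B$); $\vee$-elim (from $\Gamma\vdash A\vee B$, $\Gamma,A\vdash C$, $\Gamma,B\vdash C$ infer $\Gamma\vdash C$); $\Rightarrow$-elim (from $\Gamma\vdash A\Rightarrow B$, $\Gamma\vdash A$ infer $\Gamma\vdash B$); $\forall$-elim (from $\Gamma\vdash\forall x\,A$ infer $\Gamma\vdash(t/x)A$); $\exists$-elim (from $\Gamma\vdash\exists x\,A$, $\Gamma,A\vdash B$ infer $\Gamma\vdash B$, $x$ not free in $\Gamma,B$). A specific cut is a proof whose last rule is $\wedge$-elim, $\vee$-elim, $\Rightarrow$-elim, $\forall$-elim or $\exists$-elim, whose major premise is proved by a proof ending with $\wedge$-intro, $\vee$-intro, $\Rightarrow$-intro, $\forall$-intro or $\exists$-intro respectively; a proof is specific-cut-free if none of its sub-proofs is a specific cut. Introduce a unary modality $[\cdot]$, allowing expressions $[A]$ as propositions. The freeze function $f$: $f(A\Rightarrow B)=[A]\Rightarrow f(B)$ if $A$ is not atomic; $f(P\Rightarrow B)=P\Rightarrow f(B)$ if $P$ is atomic; $f(P)=P$ for $P$ atomic; $f(\top)=\top$, $f(\bot)=\bot$; $f(A\wedge B)=f(A)\wedge f(B)$, $f(A\vee B)=f(A)\vee f(B)$, $f(\forall x\,A)=\forall x\,f(A)$, $f(\exists x\,A)=\exists x\,f(A)$. The unfreeze function $u$: $u([A])=u(A)$, $u(P)=P$ for atomic $P$, $u(\top)=\top$, $u(\bot)=\bot$, and $u$ commutes with $\Rightarrow,\wedge,\vee,\forall,\exists$; it is extended to lists of propositions componentwise.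 The pseudo-automaton $\mathcal{A}$ is the inference system (on sequents possibly containing $[\cdot]$) formed by the introduction rules of Constructive Natural Deduction listed above (including the axiom rule) together with the delay rule, which has no premises and conclusion $\Gamma,[A]\vdash B$ (for any $\Gamma$, $A$, $B$). -}

module Defs where

open import Data.Nat using (ℕ; zero; suc)
open import Data.Bool using (Bool; true; false)
open import Data.List using (List; []; _∷_; map)
open import Data.List.Membership.Propositional using (_∈_)
open import Data.Product using (_×_)
open import Data.Unit using (⊤)
open import Data.Empty using (⊥)
open import Relation.Nullary using (¬_)
open import Data.Sum using (_⊎_)
open import Relation.Binary.PropositionalEquality using (_≡_)

-- First-order terms (de Bruijn variables; function symbols named by ℕ)

data Term : Set where
  var : ℕ → Term
  fn  : ℕ → List Term → Term

mutual
  renT : (ℕ → ℕ) → Term → Term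
  renT ρ (var x)   = var (ρ x)
  renT ρ (fn f ts) = fn f (renTs ρ ts)

  renTs : (ℕ → ℕ) → List Term → List Term
  renTs ρ []       = []
  renTs ρ (t ∷ ts) = renT ρ t ∷ renTs ρ ts

mutual
  subT : (ℕ → Term) → Term → Term
  subT σ (var x)   = σ x
  subT σ (fn f ts) = fn f (subTs σ ts)

  subTs : (ℕ → Term) → List Term → List Term
  subTs σ []       = []
  subTs σ (t ∷ ts) = subT σ t ∷ subTs σ ts

extR : (ℕ → ℕ) → ℕ → ℕ
extR ρ zero    = zero
extR ρ (suc n) = suc (ρ n)

extS : (ℕ → Term) → ℕ → Term
extS σ zero    = var zero
extS σ (suc n) = renT suc (σ n)

-- Propositions.  Fm false : ordinary propositions;
-- Fm true : propositions possibly containing the modality [_].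

data Fm : Bool → Set where
  atom : ∀ {b} → ℕ → List Term → Fm b
  ⊤′   : ∀ {b} → Fm b
  ⊥′   : ∀ {b} → Fm b
  _∧′_ : ∀ {b} → Fm b → Fm b → Fm b
  _∨′_ : ∀ {b} → Fm b → Fm b → Fm b
  _⇒′_ : ∀ {b} → Fm b → Fm b → Fm b
  ∀′   : ∀ {b} → Fm b → Fm b                  -- binds de Bruijn variable 0
  ∃′   : ∀ {b} → Fm b → Fm b
  [_]  : Fm true → Fm true

Form : Set
Form = Fm false

MForm : Set
MForm = Fm true

renF : ∀ {b} → (ℕ → ℕ) → Fm b → Fm b
renF ρ (atom p ts) = atom p (renTs ρ ts)
renF ρ ⊤′ = ⊤′
renF ρ ⊥′ = ⊥′
renF ρ (A ∧′ B) = renF ρ A ∧′ renF ρ B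
renF ρ (A ∨′ B) = renF ρ A ∨′ renF ρ B
renF ρ (A ⇒′ B) = renF ρ A ⇒′ renF ρ B
renF ρ (∀′ A) = ∀′ (renF (extR ρ) A)
renF ρ (∃′ A) = ∃′ (renF (extR ρ) A)
renF ρ [ A ] = [ renF ρ A ]

subF : ∀ {b} → (ℕ → Term) → Fm b → Fm b
subF σ (atom p ts) = atom p (subTs σ ts)
subF σ ⊤′ = ⊤′
subF σ ⊥′ = ⊥′
subF σ (A ∧′ B) = subF σ A ∧′ subF σ B
subF σ (A ∨′ B) = subF σ A ∨′ subF σ B
subF σ (A ⇒′ B) = subF σ A ⇒′ subF σ B
subF σ (∀′ A) = ∀′ (subF (extS σ) A)
subF σ (∃′ A) = ∃′ (subF (extS σ) A)
subF σ [ A ] = [ subF σ A ]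

-- weakening (shift free variables by one): used for "x not free in Γ"
wk : ∀ {b} → Fm b → Fm b
wk = renF suc

-- (t/x)A where x is the bound variable 0 of the body A
inst0 : Term → ℕ → Term
inst0 t zero    = t
inst0 t (suc n) = var n

_[_/0] : ∀ {b} → Fm b → Term → Fm b
A [ t /0] = subF (inst0 t) A

Atomic : ∀ {b} → Fm b → Set
Atomic (atom _ _) = ⊤
Atomic _          = ⊥

-- Constructive Natural Deduction (on ordinary propositions)
-- Contexts are lists; Γ , A is written A ∷ Γ; the axiom is A ∈ Γ.

infix 3 _⊢_ _⊢ᴬ_

data _⊢_ : List Form → Form → Set where
  ax   : ∀ {Γ A} → A ∈ Γ → Γ ⊢ A
  ⊤I   : ∀ {Γ} → Γ ⊢ ⊤′
  ∧I   : ∀ {Γ A B} → Γ ⊢ A → Γ ⊢ B → Γ ⊢ A ∧′ B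
  ∨I₁  : ∀ {Γ A B} → Γ ⊢ A → Γ ⊢ A ∨′ B
  ∨I₂  : ∀ {Γ A B} → Γ ⊢ B → Γ ⊢ A ∨′ B
  ⇒I   : ∀ {Γ A B} → A ∷ Γ ⊢ B → Γ ⊢ A ⇒′ B
  ∀I   : ∀ {Γ A} → map wk Γ ⊢ A → Γ ⊢ ∀′ A
  ∃I   : ∀ {Γ A} (t : Term) → Γ ⊢ A [ t /0] → Γ ⊢ ∃′ A
  ⊥E   : ∀ {Γ A} → Γ ⊢ ⊥′ → Γ ⊢ A
  ∧E₁  : ∀ {Γ A B} → Γ ⊢ A ∧′ B → Γ ⊢ A
  ∧E₂  : ∀ {Γ A B} → Γ ⊢ A ∧′ B → Γ ⊢ B
  ∨E   : ∀ {Γ A B C} → Γ ⊢ A ∨′ B → A ∷ Γ ⊢ C → B ∷ Γ ⊢ C → Γ ⊢ C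
  ⇒E   : ∀ {Γ A B} → Γ ⊢ A ⇒′ B → Γ ⊢ A → Γ ⊢ B
  ∀E   : ∀ {Γ A} (t : Term) → Γ ⊢ ∀′ A → Γ ⊢ A [ t /0]
  ∃E   : ∀ {Γ A B} → Γ ⊢ ∃′ A → A ∷ map wk Γ ⊢ wk B → Γ ⊢ B

data Rule : Set where
  r-ax r-⊤I r-∧I r-∨I₁ r-∨I₂ r-⇒I r-∀I r-∃I
    r-⊥E r-∧E₁ r-∧E₂ r-∨E r-⇒E r-∀E r-∃E : Rule

lastRule : ∀ {Γ A} → Γ ⊢ A → Rule
lastRule (ax _)     = r-ax
lastRule ⊤I         = r-⊤I
lastRule (∧I _ _)   = r-∧I
lastRule (∨I₁ _)    = r-∨I₁
lastRule (∨I₂ _)    = r-∨I₂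
lastRule (⇒I _)     = r-⇒I
lastRule (∀I _)     = r-∀I
lastRule (∃I _ _)   = r-∃I
lastRule (⊥E _)     = r-⊥E
lastRule (∧E₁ _)    = r-∧E₁
lastRule (∧E₂ _)    = r-∧E₂
lastRule (∨E _ _ _) = r-∨E
lastRule (⇒E _ _)   = r-⇒E
lastRule (∀E _ _)   = r-∀E
lastRule (∃E _ _)   = r-∃E

SpecificCut : ∀ {Γ A} → Γ ⊢ A → Set
SpecificCut (∧E₁ d)     = lastRule d ≡ r-∧I
SpecificCut (∧E₂ d)     = lastRule d ≡ r-∧I
SpecificCut (∨E d _ _)  = (lastRule d ≡ r-∨I₁) ⊎ (lastRule d ≡ r-∨I₂)
SpecificCut (⇒E d _)    = lastRule d ≡ r-⇒I
SpecificCut (∀E _ d)    = lastRule d ≡ r-∀I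
SpecificCut (∃E d _)    = lastRule d ≡ r-∃I
SpecificCut _           = ⊥

SpecificCutFree : ∀ {Γ A} → Γ ⊢ A → Set
SpecificCutFree d = ¬ SpecificCut d × Sub d
  where
  Sub : ∀ {Γ A} → Γ ⊢ A → Set
  Sub (ax _)      = ⊤
  Sub ⊤I          = ⊤
  Sub (∧I d e)    = SpecificCutFree d × SpecificCutFree e
  Sub (∨I₁ d)     = SpecificCutFree d
  Sub (∨I₂ d)     = SpecificCutFree d
  Sub (⇒I d)      = SpecificCutFree d
  Sub (∀I d)      = SpecificCutFree d
  Sub (∃I _ d)    = SpecificCutFree d
  Sub (⊥E d)      = SpecificCutFree d
  Sub (∧E₁ d)     = SpecificCutFree d
  Sub (∧E₂ d)     = SpecificCutFree d
  Sub (∨E d e e′) = SpecificCutFree d × SpecificCutFree e × SpecificCutFree e′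
  Sub (⇒E d e)    = SpecificCutFree d × SpecificCutFree e
  Sub (∀E _ d)    = SpecificCutFree d
  Sub (∃E d e)    = SpecificCutFree d × SpecificCutFree e

emb : Form → MForm
emb (atom p ts) = atom p ts
emb ⊤′ = ⊤′
emb ⊥′ = ⊥′
emb (A ∧′ B) = emb A ∧′ emb B
emb (A ∨′ B) = emb A ∨′ emb B
emb (A ⇒′ B) = emb A ⇒′ emb B
emb (∀′ A) = ∀′ (emb A)
emb (∃′ A) = ∃′ (emb A)

freeze : Form → MForm
freeze (atom p ts ⇒′ B) = atom p ts ⇒′ freeze B
freeze (A ⇒′ B)         = [ emb A ] ⇒′ freeze B
freeze (atom p ts) = atom p ts
freeze ⊤′ = ⊤′
freeze ⊥′ = ⊥′
freeze (A ∧′ B) = freeze A ∧′ freeze B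
freeze (A ∨′ B) = freeze A ∨′ freeze B
freeze (∀′ A) = ∀′ (freeze A)
freeze (∃′ A) = ∃′ (freeze A)

unfreeze : MForm → Form
unfreeze [ A ] = unfreeze A
unfreeze (atom p ts) = atom p ts
unfreeze ⊤′ = ⊤′
unfreeze ⊥′ = ⊥′
unfreeze (A ∧′ B) = unfreeze A ∧′ unfreeze B
unfreeze (A ∨′ B) = unfreeze A ∨′ unfreeze B
unfreeze (A ⇒′ B) = unfreeze A ⇒′ unfreeze B
unfreeze (∀′ A) = ∀′ (unfreeze A)
unfreeze (∃′ A) = ∃′ (unfreeze A)

data _⊢ᴬ_ : List MForm → MForm → Set where
  ax    : ∀ {Γ A} → A ∈ Γ → Γ ⊢ᴬ A
  ⊤I    : ∀ {Γ} → Γ ⊢ᴬ ⊤′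
  ∧I    : ∀ {Γ A B} → Γ ⊢ᴬ A → Γ ⊢ᴬ B → Γ ⊢ᴬ A ∧′ B
  ∨I₁   : ∀ {Γ A B} → Γ ⊢ᴬ A → Γ ⊢ᴬ A ∨′ B
  ∨I₂   : ∀ {Γ A B} → Γ ⊢ᴬ B → Γ ⊢ᴬ A ∨′ B
  ⇒I    : ∀ {Γ A B} → A ∷ Γ ⊢ᴬ B → Γ ⊢ᴬ A ⇒′ B
  ∀I    : ∀ {Γ A} → map wk Γ ⊢ᴬ A → Γ ⊢ᴬ ∀′ A
  ∃I    : ∀ {Γ A} (t : Term) → Γ ⊢ᴬ A [ t /0] → Γ ⊢ᴬ ∃′ A
  delay : ∀ {Γ A B} → [ A ] ∈ Γ → Γ ⊢ᴬ B

DelayLeaves : (List MForm → MForm → Set) → ∀ {Γ A} → Γ ⊢ᴬ A → Set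
DelayLeaves P (ax _)                  = ⊤
DelayLeaves P ⊤I                      = ⊤
DelayLeaves P (∧I d e)                = DelayLeaves P d × DelayLeaves P e
DelayLeaves P (∨I₁ d)                 = DelayLeaves P d
DelayLeaves P (∨I₂ d)                 = DelayLeaves P d
DelayLeaves P (⇒I d)                  = DelayLeaves P d
DelayLeaves P (∀I d)                  = DelayLeaves P d
DelayLeaves P (∃I _ d)                = DelayLeaves P d
DelayLeaves P (delay {Δ} {_} {B} _)   = P Δ B

module Submission where

-- Introduction rules are mirrored by the same rules of 𝒜.  An implication
-- A ⇒ B with compound premise is frozen to [A] ⇒ f(B); its 𝒜-proof is
-- ⇒-intro followed at once by a delay leaf [A], Γ ⊢ f(B), which is justified
-- because the premise d of the introduction proves u([A], Γ) ⊢ u(f(B)),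
-- i.e. A, Γ ⊢ B (unfreezing undoes freezing).  The axiom rule applies only
-- to atomic hypotheses, whose freezing is themselves.  Elimination rules never
-- occur at the root: in an atomic context, a specific-cut-free proof whose
-- last rule is not the introduction rule of its conclusion proves an atomic
-- proposition, and applied to the major premise of an elimination this is
-- absurd (that premise is ⊥ or compound).

open import Defs
open import Data.List using (List; _∷_; map)
open import Data.List.Properties using (map-∘; map-cong; map-id)
open import Data.List.Relation.Unary.All using (All; lookup)
import Data.List.Relation.Unary.All as All
open import Data.List.Relation.Unary.All.Properties using (map⁺)
open import Data.List.Membership.Propositional using (_∈_)
open import Data.List.Membership.Propositional.Properties using (∈-map⁺)
open import Data.List.Relation.Unary.Any using (here)
open import Data.Product using (Σ; _,_; zip) renaming (map to map-Σ)
open import Data.Sum using (_⊎_; inj₁; inj₂)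
open import Data.Unit using (tt)
open import Data.Bool using (Bool)
open import Data.Empty using (⊥; ⊥-elim)
open import Data.Nat using (ℕ; suc)
open import Function using (id)
open import Relation.Nullary using (¬_)
open import Relation.Binary.PropositionalEquality
  using (_≡_; refl; sym; trans; cong; cong₂; subst; subst₂)

emb-ren : (ρ : ℕ → ℕ) (A : Form) → emb (renF ρ A) ≡ renF ρ (emb A)
emb-ren ρ (atom p ts) = refl
emb-ren ρ ⊤′          = refl
emb-ren ρ ⊥′          = refl
emb-ren ρ (A ∧′ B)    = cong₂ _∧′_ (emb-ren ρ A) (emb-ren ρ B)
emb-ren ρ (A ∨′ B)    = cong₂ _∨′_ (emb-ren ρ A) (emb-ren ρ B)
emb-ren ρ (A ⇒′ B)    = cong₂ _⇒′_ (emb-ren ρ A) (emb-ren ρ B)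
emb-ren ρ (∀′ A)      = cong ∀′ (emb-ren (extR ρ) A)
emb-ren ρ (∃′ A)      = cong ∃′ (emb-ren (extR ρ) A)

emb-sub : (σ : ℕ → Term) (A : Form) → emb (subF σ A) ≡ subF σ (emb A)
emb-sub σ (atom p ts) = refl
emb-sub σ ⊤′          = refl
emb-sub σ ⊥′          = refl
emb-sub σ (A ∧′ B)    = cong₂ _∧′_ (emb-sub σ A) (emb-sub σ B)
emb-sub σ (A ∨′ B)    = cong₂ _∨′_ (emb-sub σ A) (emb-sub σ B)
emb-sub σ (A ⇒′ B)    = cong₂ _⇒′_ (emb-sub σ A) (emb-sub σ B)
emb-sub σ (∀′ A)      = cong ∀′ (emb-sub (extS σ) A)
emb-sub σ (∃′ A)      = cong ∃′ (emb-sub (extS σ) A)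

frozen-⇒-cong : {A A′ B B′ : MForm} → A ≡ A′ → B ≡ B′ →
                [ A ] ⇒′ B ≡ [ A′ ] ⇒′ B′
frozen-⇒-cong = cong₂ (λ X Y → [ X ] ⇒′ Y)

freeze-sub : (σ : ℕ → Term) (A : Form) → freeze (subF σ A) ≡ subF σ (freeze A)
freeze-sub σ (atom p ts)        = refl
freeze-sub σ ⊤′                 = refl
freeze-sub σ ⊥′                 = refl
freeze-sub σ (A ∧′ B)           = cong₂ _∧′_ (freeze-sub σ A) (freeze-sub σ B)
freeze-sub σ (A ∨′ B)           = cong₂ _∨′_ (freeze-sub σ A) (freeze-sub σ B)
freeze-sub σ (∀′ A)             = cong ∀′ (freeze-sub (extS σ) A)
freeze-sub σ (∃′ A)             = cong ∃′ (freeze-sub (extS σ) A)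
freeze-sub σ (atom p ts ⇒′ B)   = cong (atom p (subTs σ ts) ⇒′_) (freeze-sub σ B)
freeze-sub σ (A@⊤′ ⇒′ B)        = frozen-⇒-cong (emb-sub σ A) (freeze-sub σ B)
freeze-sub σ (A@⊥′ ⇒′ B)        = frozen-⇒-cong (emb-sub σ A) (freeze-sub σ B)
freeze-sub σ (A@(_ ∧′ _) ⇒′ B)  = frozen-⇒-cong (emb-sub σ A) (freeze-sub σ B)
freeze-sub σ (A@(_ ∨′ _) ⇒′ B)  = frozen-⇒-cong (emb-sub σ A) (freeze-sub σ B)
freeze-sub σ (A@(_ ⇒′ _) ⇒′ B)  = frozen-⇒-cong (emb-sub σ A) (freeze-sub σ B)
freeze-sub σ (A@(∀′ _) ⇒′ B)    = frozen-⇒-cong (emb-sub σ A) (freeze-sub σ B)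
freeze-sub σ (A@(∃′ _) ⇒′ B)    = frozen-⇒-cong (emb-sub σ A) (freeze-sub σ B)

unfreeze-emb : (A : Form) → unfreeze (emb A) ≡ A
unfreeze-emb (atom p ts) = refl
unfreeze-emb ⊤′          = refl
unfreeze-emb ⊥′          = refl
unfreeze-emb (A ∧′ B)    = cong₂ _∧′_ (unfreeze-emb A) (unfreeze-emb B)
unfreeze-emb (A ∨′ B)    = cong₂ _∨′_ (unfreeze-emb A) (unfreeze-emb B)
unfreeze-emb (A ⇒′ B)    = cong₂ _⇒′_ (unfreeze-emb A) (unfreeze-emb B)
unfreeze-emb (∀′ A)      = cong ∀′ (unfreeze-emb A)
unfreeze-emb (∃′ A)      = cong ∃′ (unfreeze-emb A)

unfreeze-freeze : (A : Form) → unfreeze (freeze A) ≡ A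
unfreeze-freeze (atom p ts)       = refl
unfreeze-freeze ⊤′                = refl
unfreeze-freeze ⊥′                = refl
unfreeze-freeze (A ∧′ B)          = cong₂ _∧′_ (unfreeze-freeze A) (unfreeze-freeze B)
unfreeze-freeze (A ∨′ B)          = cong₂ _∨′_ (unfreeze-freeze A) (unfreeze-freeze B)
unfreeze-freeze (∀′ A)            = cong ∀′ (unfreeze-freeze A)
unfreeze-freeze (∃′ A)            = cong ∃′ (unfreeze-freeze A)
unfreeze-freeze (atom p ts ⇒′ B)  = cong (atom p ts ⇒′_) (unfreeze-freeze B)
unfreeze-freeze (A@⊤′ ⇒′ B)       = cong₂ _⇒′_ (unfreeze-emb A) (unfreeze-freeze B)
unfreeze-freeze (A@⊥′ ⇒′ B)       = cong₂ _⇒′_ (unfreeze-emb A) (unfreeze-freeze B)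
unfreeze-freeze (A@(_ ∧′ _) ⇒′ B) = cong₂ _⇒′_ (unfreeze-emb A) (unfreeze-freeze B)
unfreeze-freeze (A@(_ ∨′ _) ⇒′ B) = cong₂ _⇒′_ (unfreeze-emb A) (unfreeze-freeze B)
unfreeze-freeze (A@(_ ⇒′ _) ⇒′ B) = cong₂ _⇒′_ (unfreeze-emb A) (unfreeze-freeze B)
unfreeze-freeze (A@(∀′ _) ⇒′ B)   = cong₂ _⇒′_ (unfreeze-emb A) (unfreeze-freeze B)
unfreeze-freeze (A@(∃′ _) ⇒′ B)   = cong₂ _⇒′_ (unfreeze-emb A) (unfreeze-freeze B)

freeze-compound-⇒ : (A B : Form) → ¬ Atomic A → freeze (A ⇒′ B) ≡ [ emb A ] ⇒′ freeze B
freeze-compound-⇒ (atom p ts) B compound = ⊥-elim (compound tt)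
freeze-compound-⇒ ⊤′          B _        = refl
freeze-compound-⇒ ⊥′          B _        = refl
freeze-compound-⇒ (_ ∧′ _)    B _        = refl
freeze-compound-⇒ (_ ∨′ _)    B _        = refl
freeze-compound-⇒ (_ ⇒′ _)    B _        = refl
freeze-compound-⇒ (∀′ _)      B _        = refl
freeze-compound-⇒ (∃′ _)      B _        = refl

map-emb-wk : (Γ : List Form) → map emb (map wk Γ) ≡ map wk (map emb Γ)
map-emb-wk Γ = trans (sym (map-∘ Γ)) (trans (map-cong (emb-ren suc) Γ) (map-∘ Γ))

map-unfreeze-emb : (Γ : List Form) → map unfreeze (map emb Γ) ≡ Γ
map-unfreeze-emb Γ = trans (sym (map-∘ Γ)) (trans (map-cong unfreeze-emb Γ) (map-id Γ))

ren-atomic : {b : Bool} (ρ : ℕ → ℕ) {A : Fm b} → Atomic A → Atomic (renF ρ A)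
ren-atomic ρ {atom _ _} _ = tt

-- IntroFor C r: r is an introduction rule for the main connective of C.
-- For the major premise of each elimination, "not IntroFor" is exactly
-- "this elimination is not a specific cut".
IntroFor : Form → Rule → Set
IntroFor (atom _ _) r = ⊥
IntroFor ⊥′         r = ⊥
IntroFor ⊤′         r = r ≡ r-⊤I
IntroFor (_ ∧′ _)   r = r ≡ r-∧I
IntroFor (_ ∨′ _)   r = (r ≡ r-∨I₁) ⊎ (r ≡ r-∨I₂)
IntroFor (_ ⇒′ _)   r = r ≡ r-⇒I
IntroFor (∀′ _)     r = r ≡ r-∀I
IntroFor (∃′ _)     r = r ≡ r-∃I

-- For an elimination this is absurd: by induction its major premise would
-- prove an atomic proposition, while it proves ⊥ or a compound one.
non-intro-atomic : {Γ : List Form} {C : Form} → All Atomic Γ →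
                   (d : Γ ⊢ C) → SpecificCutFree d →
                   ¬ IntroFor C (lastRule d) → Atomic C
non-intro-atomic at (ax i)     _ _  = lookup at i
non-intro-atomic at ⊤I         _ ni = ⊥-elim (ni refl)
non-intro-atomic at (∧I _ _)   _ ni = ⊥-elim (ni refl)
non-intro-atomic at (∨I₁ _)    _ ni = ⊥-elim (ni (inj₁ refl))
non-intro-atomic at (∨I₂ _)    _ ni = ⊥-elim (ni (inj₂ refl))
non-intro-atomic at (⇒I _)     _ ni = ⊥-elim (ni refl)
non-intro-atomic at (∀I _)     _ ni = ⊥-elim (ni refl)
non-intro-atomic at (∃I _ _)   _ ni = ⊥-elim (ni refl)
non-intro-atomic at (⊥E m)     (_ , cm)      _ = ⊥-elim (non-intro-atomic at m cm λ ())
non-intro-atomic at (∧E₁ m)    (nc , cm)     _ = ⊥-elim (non-intro-atomic at m cm nc)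
non-intro-atomic at (∧E₂ m)    (nc , cm)     _ = ⊥-elim (non-intro-atomic at m cm nc)
non-intro-atomic at (∨E m _ _) (nc , cm , _) _ = ⊥-elim (non-intro-atomic at m cm nc)
non-intro-atomic at (⇒E m _)   (nc , cm , _) _ = ⊥-elim (non-intro-atomic at m cm nc)
non-intro-atomic at (∀E _ m)   (nc , cm)     _ = ⊥-elim (non-intro-atomic at m cm nc)
non-intro-atomic at (∃E m _)   (nc , cm , _) _ = ⊥-elim (non-intro-atomic at m cm nc)

Justified : List MForm → MForm → Set
Justified Δ B = map unfreeze Δ ⊢ unfreeze B

Translation : List MForm → MForm → Set
Translation Δ C = Σ (Δ ⊢ᴬ C) (DelayLeaves Justified)

translate-axiom : {Γ : List Form} {A : Form} → Atomic A → A ∈ Γ →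
                  Translation (map emb Γ) (freeze A)
translate-axiom {A = atom _ _} _ i = ax (∈-map⁺ emb i) , tt

translate-delayed-⇒ : {Γ : List Form} (A B : Form) → ¬ Atomic A → A ∷ Γ ⊢ B →
                      Translation (map emb Γ) (freeze (A ⇒′ B))
translate-delayed-⇒ {Γ} A B compound d =
  subst (Translation (map emb Γ)) (sym (freeze-compound-⇒ A B compound))
    (⇒I (delay (here refl)) , leaf)
  where
  leaf : Justified ([ emb A ] ∷ map emb Γ) (freeze B)
  leaf = subst₂ _⊢_ (sym (cong₂ _∷_ (unfreeze-emb A) (map-unfreeze-emb Γ)))
                    (sym (unfreeze-freeze B)) d

translate : {Γ : List Form} {A : Form} → All Atomic Γ →
            (d : Γ ⊢ A) → SpecificCutFree d → Translation (map emb Γ) (freeze A)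
translate at (ax i)   _ = translate-axiom (lookup at i) i
translate at ⊤I       _ = ⊤I , tt
translate at (∧I d e) (_ , cd , ce) = zip ∧I _,_ (translate at d cd) (translate at e ce)
translate at (∨I₁ d)  (_ , cd) = map-Σ ∨I₁ id (translate at d cd)
translate at (∨I₂ d)  (_ , cd) = map-Σ ∨I₂ id (translate at d cd)
translate at (⇒I {A = atom _ _} d) (_ , cd) = map-Σ ⇒I id (translate (tt All.∷ at) d cd)
translate at (⇒I {A = A@⊤′}        {B} d) _ = translate-delayed-⇒ A B (λ ()) d
translate at (⇒I {A = A@⊥′}        {B} d) _ = translate-delayed-⇒ A B (λ ()) d
translate at (⇒I {A = A@(_ ∧′ _)}  {B} d) _ = translate-delayed-⇒ A B (λ ()) d
translate at (⇒I {A = A@(_ ∨′ _)}  {B} d) _ = translate-delayed-⇒ A B (λ ()) d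
translate at (⇒I {A = A@(_ ⇒′ _)}  {B} d) _ = translate-delayed-⇒ A B (λ ()) d
translate at (⇒I {A = A@(∀′ _)}    {B} d) _ = translate-delayed-⇒ A B (λ ()) d
translate at (⇒I {A = A@(∃′ _)}    {B} d) _ = translate-delayed-⇒ A B (λ ()) d
translate {Γ} at (∀I {A = A} d) (_ , cd) =
  map-Σ ∀I id (subst (λ Δ → Translation Δ (freeze A)) (map-emb-wk Γ)
                     (translate (map⁺ (All.map (ren-atomic suc) at)) d cd))
translate at (∃I {A = A} t d) (_ , cd) =
  map-Σ (∃I t) id (subst (Translation _) (freeze-sub (inst0 t) A) (translate at d cd))
translate at (⊥E m)     (_ , cm)      = ⊥-elim (non-intro-atomic at m cm λ ())
translate at (∧E₁ m)    (nc , cm)     = ⊥-elim (non-intro-atomic at m cm nc)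
translate at (∧E₂ m)    (nc , cm)     = ⊥-elim (non-intro-atomic at m cm nc)
translate at (∨E m _ _) (nc , cm , _) = ⊥-elim (non-intro-atomic at m cm nc)
translate at (⇒E m _)   (nc , cm , _) = ⊥-elim (non-intro-atomic at m cm nc)
translate at (∀E _ m)   (nc , cm)     = ⊥-elim (non-intro-atomic at m cm nc)
translate at (∃E m _)   (nc , cm , _) = ⊥-elim (non-intro-atomic at m cm nc)

theorem3 : (Γ : List Form) (A : Form) → All Atomic Γ →
    (d : Γ ⊢ A) → SpecificCutFree d →
    Σ (map emb Γ ⊢ᴬ freeze A)
      (λ π → DelayLeaves (λ Δ B → map unfreeze Δ ⊢ unfreeze B) π)
theorem3 Γ A atomic-context d cut-free = translate atomic-context d cut-free
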